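{- Let $L\geq 2$ be an integer, $H=(V_H,E_H)$ a directed acyclic graph, and $G$ the graph constructed from $H$ as described in the context. Let $S$ be a feasible bootstrap solution for $(L,G)$ that contains a blue vertex $w_i^{(v)}$ for some $v\in V_H$ and some integer $i$. Then $(S\setminus\{w_i^{(v)}\})\cup\{v\}$ is also a feasible bootstrap solution for $(L,G)$.
   Context: Bootstrap problem: input a positive integer $L$ and a DAG $G=(V,E)$ (parallel edges allowed) with every vertex of indegree $0$ (white) or $2$ (blue or red). For $S\subseteq V$, define $\ell(v)=0$ if $v$ white, $\ell(v)=\max_{(u,v)\in E}\ell(u)\mathbb{1}_{V\setminus S}(u)$ if $v$ blue, $\ell(v)=\max_{(u,v)\in E}\ell(u)\mathbb{1}_{V\setminus S}(u)+1$ if $v$ red, where $\mathbb{1}_{V\setminus S}$ is $1$ off $S$ and $0$ on $S$; $S$ is feasible if $\max_u\ell(u)\leq L$. Construction of $G$ from $H$: the vertex set contains $V_H$, a clone set $V_H'=\{v':v\in V_H\}$, and a new vertex $s_0$; vertices of $V_H\cup V_H'$ are red and $s_0$ is white. For every $v\in V_H$ add two copies of the edge $(v,v')$. For every $v\in V_H$ with indegree at most $2$ in $H$, keep the edges of $E_H$ entering $v$ and add $(2-\mathrm{indeg}_H(v))$ copies of $(s_0,v)$. For every $v\in V_H$ with indegree $d\geq 3$ in $H$, with direct predecessors $v_1,\dots,v_d$, do not keep the edges $(v_i,v)$; instead add new blue vertices $w_1^{(v)},\dots,w_d^{(v)}$ and the edges: two copies of $(v_1,w_1^{(v)})$; for $i=2,\dots,d$,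 an edge $(w_{i-1}^{(v)},w_i^{(v)})$ and an edge $(v_i,w_i^{(v)})$; and two copies of $(w_d^{(v)},v)$. -}

module Defs where

open import Data.Nat using (ℕ; zero; suc; _≤_; _<_; _∸_; _⊔_; _≤?_; _≡ᵇ_; s≤s)
open import Data.Nat.Properties using (≤-refl; ≤-trans; n≤1+n; ≰⇒>)
open import Data.Fin using (Fin; fromℕ<)
import Data.Fin as F
open import Data.List using (List; []; _∷_; _++_; length; lookup; map; replicate; foldr)
open import Data.List.Membership.Propositional using (_∈_)
open import Data.Bool using (Bool; true; false; if_then_else_; _∧_)
open import Relation.Nullary using (yes; no)
open import Relation.Nullary.Decidable using (⌊_⌋)
open import Relation.Binary.PropositionalEquality using (_≡_)
open import Induction.WellFounded using (WellFounded)

-- Generic bootstrap problem on a DAG given by in-edge lists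
-- (the multiset of edges (u,x) entering x is the list `pred x`,
-- so parallel edges are allowed).

data Colour : Set where
  white blue red : Colour

module Bootstrap {V : Set} (pred : V → List V) (colour : V → Colour) where

  contrib : (S : V → Bool) → (V → ℕ) → V → ℕ
  contrib S ℓ u = if S u then 0 else ℓ u

  maxPred : (S : V → Bool) → (V → ℕ) → V → ℕ
  maxPred S ℓ x = foldr _⊔_ 0 (map (contrib S ℓ) (pred x))

  IsLabelling : (S : V → Bool) → (V → ℕ) → Set
  IsLabelling S ℓ = ∀ x → ℓ x ≡ rhs (colour x) x
    where
    rhs : Colour → V → ℕ
    rhs white x = 0
    rhs blue  x = maxPred S ℓ x
    rhs red   x = suc (maxPred S ℓ x)

  -- S is feasible for L: the (in a DAG unique) labelling satisfies max ℓ ≤ L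
  Feasible : ℕ → (V → Bool) → Set
  Feasible L S = ∀ ℓ → IsLabelling S ℓ → ∀ x → ℓ x ≤ L

-- The input digraph H, vertices Fin n, in-edges of v listed in `pred v`
-- (this list also fixes the ordering v₁,…,v_d of the predecessors).

record Digraph : Set where
  field
    n    : ℕ
    pred : Fin n → List (Fin n)

  indeg : Fin n → ℕ
  indeg v = length (pred v)

open Digraph public

Acyclic : Digraph → Set
Acyclic H = WellFounded (λ u v → u ∈ pred H v)

-- w H v k p q stands for w_{k+1}^{(v)} (k = 0,…,d-1, d = indeg v ≥ 3).
data GV (H : Digraph) : Set where
  orig  : Fin (n H) → GV H
  clone : Fin (n H) → GV H
  s₀    : GV H
  w     : (v : Fin (n H)) (k : ℕ) → 3 ≤ indeg H v → k < indeg H v → GV H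

private
  last< : ∀ {d} → 3 ≤ d → d ∸ 1 < d
  last< (s≤s _) = ≤-refl

colourG : (H : Digraph) → GV H → Colour
colourG H (orig _)      = red
colourG H (clone _)     = red
colourG H s₀            = white
colourG H (w _ _ _ _)   = blue

predG : (H : Digraph) → GV H → List (GV H)
predG H (orig v) with indeg H v ≤? 2
... | yes _ = map orig (pred H v) ++ replicate (2 ∸ indeg H v) s₀
... | no d≰2 = let p = ≰⇒> d≰2
                   wd = w v (indeg H v ∸ 1) p (last< p)
               in wd ∷ wd ∷ []
predG H (clone v) = orig v ∷ orig v ∷ []
predG H s₀ = []
predG H (w v zero p q) =
  let u = orig (lookup (pred H v) (fromℕ< q)) in u ∷ u ∷ []
predG H (w v (suc j) p q) =
  w v j p (≤-trans (n≤1+n (suc j)) q) ∷ orig (lookup (pred H v) (fromℕ< q)) ∷ []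

module BootstrapG (H : Digraph) = Bootstrap (predG H) (colourG H)

FeasibleG : (H : Digraph) → ℕ → (GV H → Bool) → Set
FeasibleG H = BootstrapG.Feasible H

isW : (H : Digraph) → Fin (n H) → ℕ → GV H → Bool
isW H v k (w v' k' _ _) = ⌊ v F.≟ v' ⌋ ∧ (k ≡ᵇ k')
isW H v k _ = false

isOrig : (H : Digraph) → Fin (n H) → GV H → Bool
isOrig H v (orig v') = ⌊ v F.≟ v' ⌋
isOrig H v _ = false

replaceW : (H : Digraph) → (GV H → Bool) → Fin (n H) → ℕ → GV H → Bool
replaceW H S v k x =
  if isW H v k x then false else (if isOrig H v x then true else S x)

module Submission where

-- The clone x′ of a vertex x of H has label 1 + (contribution of x), so a set
-- whose clone labels are all ≤ L forces every vertex of H to contribute at most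
-- L − 1; then every gadget vertex w has label ≤ L − 1 and every vertex of H label
-- ≤ L. So it suffices to bound the clone labels after the exchange. Compared with
-- S, the new set only adds v and removes w_k^{(v)}, so the label of every vertex
-- other than v and w_j^{(v)} (j ≥ k) can only decrease, and clones are among them.

open import Defs
open import Data.Nat using (ℕ; zero; suc; _≤_; _<_; _⊔_; _≤?_; _≡ᵇ_; z≤n; s≤s; s≤s⁻¹)
open import Data.Nat.Properties
  using (≤-refl; ≤-reflexive; ≤-trans; ⊔-lub; ⊔-mono-≤; m≤m⊔n; n≤1+n; module ≤-Reasoning)
import Data.Fin as Fin
open import Data.Fin using (Fin)
open import Data.Bool using (Bool; true; false; if_then_else_)
open import Data.List using (List; []; _∷_; map; foldr; replicate)
open import Data.List.Membership.Propositional using (_∈_; mapWith∈)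
open import Data.List.Membership.Propositional.Properties
  using (mapWith∈-cong; mapWith∈≗map; ∈-map⁻; ∈-++⁻; ∈-lookup)
open import Data.List.Relation.Unary.Any using (here; there)
open import Data.Product using (_×_; _,_)
open import Data.Sum using (_⊎_; inj₁; inj₂)
open import Data.Empty using (⊥-elim)
open import Data.Unit using (⊤; tt)
open import Function using (const; _∘_)
open import Induction.WellFounded using (WellFounded; WfRec; Acc; acc; module All; module FixPoint)
open import Relation.Nullary using (¬_; yes; no)
open import Relation.Binary.PropositionalEquality using (_≡_; refl; sym; cong; module ≡-Reasoning)

max-map-mono : ∀ {A : Set} (xs : List A) {f g : A → ℕ} → (∀ {u} → u ∈ xs → f u ≤ g u) →
  foldr _⊔_ 0 (map f xs) ≤ foldr _⊔_ 0 (map g xs)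
max-map-mono []       f≤g = z≤n
max-map-mono (x ∷ xs) f≤g = ⊔-mono-≤ (f≤g (here refl)) (max-map-mono xs (f≤g ∘ there))

max-map-lub : ∀ {A : Set} {m} (xs : List A) {f : A → ℕ} → (∀ {u} → u ∈ xs → f u ≤ m) →
  foldr _⊔_ 0 (map f xs) ≤ m
max-map-lub []       f≤m = z≤n
max-map-lub (x ∷ xs) f≤m = ⊔-lub (f≤m (here refl)) (max-map-lub xs (f≤m ∘ there))

labelOf : Colour → ℕ → ℕ
labelOf white _ = 0
labelOf blue  m = m
labelOf red   m = suc m

labelOf-mono : ∀ c {m n} → m ≤ n → labelOf c m ≤ labelOf c n
labelOf-mono white m≤n = z≤n
labelOf-mono blue  m≤n = m≤n
labelOf-mono red   m≤n = s≤s m≤n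

module BootstrapProperties {V : Set} (pred : V → List V) (colour : V → Colour) where
  open Bootstrap pred colour

  IsLabelling⇒≡ : ∀ {S ℓ} → IsLabelling S ℓ → ∀ x → ℓ x ≡ labelOf (colour x) (maxPred S ℓ x)
  IsLabelling⇒≡ lab x with colour x | lab x
  ... | white | eq = eq
  ... | blue  | eq = eq
  ... | red   | eq = eq

  ≡⇒IsLabelling : ∀ {S ℓ} → (∀ x → ℓ x ≡ labelOf (colour x) (maxPred S ℓ x)) → IsLabelling S ℓ
  ≡⇒IsLabelling eqs x with colour x | eqs x
  ... | white | eq = eq
  ... | blue  | eq = eq
  ... | red   | eq = eq

  contrib≤ : ∀ S ℓ u → contrib S ℓ u ≤ ℓ u
  contrib≤ S ℓ u with S u
  ... | true  = z≤n
  ... | false = ≤-refl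

  contrib-mono : ∀ {S S′ ℓ ℓ′ u} → S′ u ≡ S u → ℓ′ u ≤ ℓ u → contrib S′ ℓ′ u ≤ contrib S ℓ u
  contrib-mono {S} {u = u} S′u≡Su ℓ′≤ℓ rewrite S′u≡Su with S u
  ... | true  = z≤n
  ... | false = ℓ′≤ℓ

  contrib-∈ : ∀ {S ℓ u} → S u ≡ true → contrib S ℓ u ≡ 0
  contrib-∈ S∋u rewrite S∋u = refl

  _⇾_ : V → V → Set
  u ⇾ x = u ∈ pred x

  module _ (wf : WellFounded _⇾_) (S : V → Bool) where

    private
      labelStep : ∀ x → WfRec _⇾_ (const ℕ) x → ℕ
      labelStep x rec =
        labelOf (colour x) (foldr _⊔_ 0 (mapWith∈ (pred x) (λ {u} u⇾x → if S u then 0 else rec u⇾x)))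

      labelStep-ext : ∀ x {rec rec′ : WfRec _⇾_ (const ℕ) x} →
        (∀ {u} (u⇾x : u ⇾ x) → rec u⇾x ≡ rec′ u⇾x) → labelStep x rec ≡ labelStep x rec′
      labelStep-ext x rec≗rec′ = cong (λ ms → labelOf (colour x) (foldr _⊔_ 0 ms))
        (mapWith∈-cong (pred x) _ _ (λ {u} u⇾x → cong (if S u then 0 else_) (rec≗rec′ u⇾x)))

    labelling : V → ℕ
    labelling = All.wfRec wf _ (const ℕ) labelStep

    labelling-isLabelling : IsLabelling S labelling
    labelling-isLabelling = ≡⇒IsLabelling λ x → begin
      labelling x                                            ≡⟨ FixPoint.unfold-wfRec wf _ labelStep labelStep-ext ⟩
      labelStep x (λ {u} _ → labelling u)                    ≡⟨ cong (λ ms → labelOf (colour x) (foldr _⊔_ 0 ms))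
                                                                     (mapWith∈≗map (contrib S labelling) (pred x)) ⟩
      labelOf (colour x) (maxPred S labelling x)             ∎
      where open ≡-Reasoning

  module _ (wf : WellFounded _⇾_) {S S′ : V → Bool} {ℓ ℓ′ : V → ℕ}
           (lab : IsLabelling S ℓ) (lab′ : IsLabelling S′ ℓ′) where

    labelling-dominated : (P : V → Set) →
      (∀ {u x} → P x → u ⇾ x → S′ u ≡ true ⊎ (P u × S′ u ≡ S u)) →
      ∀ x → P x → ℓ′ x ≤ ℓ x
    labelling-dominated P closed = All.wfRec wf _ (λ x → P x → ℓ′ x ≤ ℓ x) step
      where
      step : ∀ x → WfRec _⇾_ (λ y → P y → ℓ′ y ≤ ℓ y) x → P x → ℓ′ x ≤ ℓ x
      step x ih Px = begin
        ℓ′ x                                 ≡⟨ IsLabelling⇒≡ lab′ x ⟩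
        labelOf (colour x) (maxPred S′ ℓ′ x) ≤⟨ labelOf-mono (colour x) (max-map-mono (pred x) contrib≤contrib) ⟩
        labelOf (colour x) (maxPred S ℓ x)   ≡⟨ IsLabelling⇒≡ lab x ⟨
        ℓ x                                  ∎
        where
        open ≤-Reasoning
        contrib≤contrib : ∀ {u} → u ⇾ x → contrib S′ ℓ′ u ≤ contrib S ℓ u
        contrib≤contrib u⇾x with closed Px u⇾x
        ... | inj₁ S′∋u rewrite contrib-∈ {S′} {ℓ′} S′∋u = z≤n
        ... | inj₂ (Pu , S′u≡Su) = contrib-mono {S} {S′} {ℓ} {ℓ′} S′u≡Su (ih u⇾x Pu)

∈-replicate⁻ : ∀ {A : Set} {x y : A} m → x ∈ replicate m y → x ≡ y
∈-replicate⁻ (suc m) (here x≡y)   = x≡y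
∈-replicate⁻ (suc m) (there x∈ys) = ∈-replicate⁻ m x∈ys

>⇒≡ᵇ-false : ∀ {m n} → n < m → (m ≡ᵇ n) ≡ false
>⇒≡ᵇ-false {suc m} {zero}  _         = refl
>⇒≡ᵇ-false {suc m} {suc n} (s≤s n<m) = >⇒≡ᵇ-false n<m

module Construction (H : Digraph) where
  open Bootstrap (predG H) (colourG H)
  open BootstrapProperties (predG H) (colourG H)

  data OrigPredView (v : Fin (n H)) : GV H → Set where
    orig-pred : ∀ {u} → u ∈ pred H v → OrigPredView v (orig u)
    s₀-pred   : OrigPredView v s₀
    w-pred    : ∀ j p q → OrigPredView v (w v j p q)

  origPredView : ∀ v {y} → y ⇾ orig v → OrigPredView v y
  origPredView v y⇾v with indeg H v ≤? 2
  origPredView v y⇾v | yes _ with ∈-++⁻ (map orig (pred H v)) y⇾v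
  ... | inj₂ y∈s₀s rewrite ∈-replicate⁻ _ y∈s₀s = s₀-pred
  ... | inj₁ y∈preds with ∈-map⁻ orig y∈preds
  ...   | _ , u∈pred , refl = orig-pred u∈pred
  origPredView v (here refl)         | no _ = w-pred _ _ _
  origPredView v (there (here refl)) | no _ = w-pred _ _ _

  acc-s₀ : Acc _⇾_ s₀
  acc-s₀ = acc λ ()

  acc-w : ∀ {v} → (∀ {u} → u ∈ pred H v → Acc _⇾_ (orig u)) → ∀ j p q → Acc _⇾_ (w v j p q)
  acc-w accPred zero    p q = acc λ { (here refl) → accPred (∈-lookup _) ; (there (here refl)) → accPred (∈-lookup _) }
  acc-w accPred (suc j) p q = acc λ { (here refl) → acc-w accPred j p _ ; (there (here refl)) → accPred (∈-lookup _) }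

  acc-orig : ∀ {v} → Acc (λ u v → u ∈ pred H v) v → Acc _⇾_ (orig v)
  acc-orig {v} (acc rs) = acc λ y⇾v → fromView (origPredView v y⇾v)
    where
    fromView : ∀ {y} → OrigPredView v y → Acc _⇾_ y
    fromView (orig-pred u∈pred) = acc-orig (rs u∈pred)
    fromView s₀-pred            = acc-s₀
    fromView (w-pred j p q)     = acc-w (λ u∈pred → acc-orig (rs u∈pred)) j p q

  Acyclic⇒wellFounded : Acyclic H → WellFounded _⇾_
  Acyclic⇒wellFounded acyclic (orig v)    = acc-orig (acyclic v)
  Acyclic⇒wellFounded acyclic (clone v)   = acc λ { (here refl) → acc-orig (acyclic v) ; (there (here refl)) → acc-orig (acyclic v) }
  Acyclic⇒wellFounded acyclic s₀          = acc-s₀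
  Acyclic⇒wellFounded acyclic (w v j p q) = acc-w (λ _ → acc-orig (acyclic _)) j p q

  module _ {T : GV H → Bool} {ℓ : GV H → ℕ} (lab : IsLabelling T ℓ) {M : ℕ}
           (clone≤ : ∀ u → ℓ (clone u) ≤ suc M) where

    orig-contrib≤ : ∀ u → contrib T ℓ (orig u) ≤ M
    orig-contrib≤ u = ≤-trans (m≤m⊔n _ _) (s≤s⁻¹ (≤-trans (≤-reflexive (sym (lab (clone u)))) (clone≤ u)))

    w-label≤ : ∀ v j p q → ℓ (w v j p q) ≤ M
    w-label≤ v zero    p q rewrite lab (w v zero p q) =
      ⊔-lub (orig-contrib≤ _) (⊔-lub (orig-contrib≤ _) z≤n)
    w-label≤ v (suc j) p q rewrite lab (w v (suc j) p q) =
      ⊔-lub (≤-trans (contrib≤ T ℓ _) (w-label≤ v j p _)) (⊔-lub (orig-contrib≤ _) z≤n)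

    clone-bounded⇒bounded : ∀ x → ℓ x ≤ suc M
    clone-bounded⇒bounded (orig v)    rewrite lab (orig v) = s≤s (max-map-lub (predG H (orig v)) pred≤)
      where
      pred≤ : ∀ {y} → y ⇾ orig v → contrib T ℓ y ≤ M
      pred≤ y⇾v with origPredView v y⇾v
      ... | orig-pred {u} _ = orig-contrib≤ u
      ... | s₀-pred         = ≤-trans (contrib≤ T ℓ s₀) (≤-trans (≤-reflexive (lab s₀)) z≤n)
      ... | w-pred j p q    = ≤-trans (contrib≤ T ℓ _) (w-label≤ v j p q)
    clone-bounded⇒bounded (clone u)   = clone≤ u
    clone-bounded⇒bounded s₀          rewrite lab s₀ = z≤n
    clone-bounded⇒bounded (w v j p q) = ≤-trans (w-label≤ v j p q) (n≤1+n M)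

  module _ (S : GV H → Bool) (v : Fin (n H)) (k : ℕ) where

    Unaffected : GV H → Set
    Unaffected (orig u)      = ¬ u ≡ v
    Unaffected (w v′ j _ _)  = v′ ≡ v → j < k
    Unaffected _             = ⊤

    replaceW-unaffected : ∀ {x} → Unaffected x → replaceW H S v k x ≡ S x
    replaceW-unaffected {orig u} u≢v with v Fin.≟ u
    ... | yes v≡u = ⊥-elim (u≢v (sym v≡u))
    ... | no  _   = refl
    replaceW-unaffected {clone u} _ = refl
    replaceW-unaffected {s₀}      _ = refl
    replaceW-unaffected {w v′ j p q} j<k with v Fin.≟ v′
    ... | no  _    = refl
    ... | yes refl rewrite >⇒≡ᵇ-false (j<k refl) = refl

    replaceW-orig : replaceW H S v k (orig v) ≡ true
    replaceW-orig with v Fin.≟ v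
    ... | yes _   = refl
    ... | no  v≢v = ⊥-elim (v≢v refl)

    private
      Closed : GV H → Set
      Closed u = replaceW H S v k u ≡ true ⊎ (Unaffected u × replaceW H S v k u ≡ S u)

      unaffected : ∀ {u} → Unaffected u → Closed u
      unaffected Uu = inj₂ (Uu , replaceW-unaffected Uu)

      orig-closed : ∀ u → Closed (orig u)
      orig-closed u with u Fin.≟ v
      ... | yes refl = inj₁ replaceW-orig
      ... | no  u≢v  = unaffected u≢v

    unaffected-closed : ∀ {u x} → Unaffected x → u ⇾ x → Closed u
    unaffected-closed {x = orig u} u≢v y⇾u with origPredView u y⇾u
    ... | orig-pred {u′} _ = orig-closed u′
    ... | s₀-pred          = unaffected tt
    ... | w-pred j p q     = unaffected λ u≡v → ⊥-elim (u≢v u≡v)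
    unaffected-closed {x = clone u}            _ (here refl)         = orig-closed u
    unaffected-closed {x = clone u}            _ (there (here refl)) = orig-closed u
    unaffected-closed {x = w v′ zero p q}      _ (here refl)         = orig-closed _
    unaffected-closed {x = w v′ zero p q}      _ (there (here refl)) = orig-closed _
    unaffected-closed {x = w v′ (suc j) p q} j<k (here refl)         = unaffected λ v′≡v → ≤-trans (n≤1+n _) (j<k v′≡v)
    unaffected-closed {x = w v′ (suc j) p q}   _ (there (here refl)) = orig-closed _

open Construction

proposition1 : (L : ℕ) → 2 ≤ L → (H : Digraph) → Acyclic H →
    (S : GV H → Bool) → FeasibleG H L S →
    (v : Fin (n H)) (k : ℕ) (p : 3 ≤ indeg H v) (q : k < indeg H v) →
    S (w v k p q) ≡ true →
    FeasibleG H L (replaceW H S v k)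
proposition1 (suc M) _ H acyclic S feasible v k _ _ _ ℓ′ lab′ =
  clone-bounded⇒bounded H lab′ λ u → begin
    ℓ′ (clone u)             ≤⟨ labelling-dominated wf lab lab′ (Unaffected H S v k) (unaffected-closed H S v k) (clone u) tt ⟩
    labelling wf S (clone u) ≤⟨ feasible _ lab (clone u) ⟩
    suc M                    ∎
  where
  open BootstrapProperties (predG H) (colourG H)
  open ≤-Reasoning

  wf : WellFounded _⇾_
  wf = Acyclic⇒wellFounded H acyclic

  lab : Bootstrap.IsLabelling (predG H) (colourG H) S (labelling wf S)
  lab = labelling-isLabelling wf S
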